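{- Let $l\geq 4$, $k\geq 1$, and let $G$ be a graph containing an induced cloning component $X$ of length $l$ with vertices $a_i,b_i,c_i$ ($0\le i\le l-1$), in which the pairs $c_{i+1}b_i$ are forbidden in the instance $(G,k)$. Let $A$ be a set of non-edges of $G$ such that $|A|\leq k$ and $G \cup A$ is prison-free. Then either $\{a_ic_i \mid 0 \leq i \leq l-1\} \cap A=\emptyset$, or $a_ic_i \in A$ for every $0 \leq i \leq l-1$. Furthermore, in the latter case all of $V(X)$ is contained in a single complete multipartite component of $G \cup A$ (i.e. in a single set of $\mathrm{cmd}_4(G\cup A)$).
   Context: The prison is the 5-vertex graph obtained from $K_5$ by deleting two edges that share an endpoint; a graph is prison-free if it has no induced subgraph isomorphic to the prison. $G\cup A$ is the graph obtained from $G$ by adding the pairs in $A$ as edges. A propagational component is the graph on vertices $1,\dots,5$ with edge set $\{13,14,15,24,25,34,35\}$ (so its non-edges are $e_1=45$, $e_2=12$, $e_3=23$). A cloning component of length $l$ is the graph on vertices $a_0,\dots,a_{l-1},b_0,\dots,b_{l-1},c_0,\dots,c_{l-1}$ (indices modulo $l$) whose edge set is the union, over $0\le i\le l-1$, of the edges making $(a_{i+1},c_{i+1},b_i,c_i,a_i)$, taken in the role of $(1,2,3,4,5)$, a propagational component, i.e. the edges $a_{i+1}b_i,\ a_{i+1}c_i,\ a_{i+1}a_i,\ c_{i+1}c_i,\ c_{i+1}a_i,\ b_ic_i,\ b_ia_i$; thus $a_ic_i$, $a_{i+1}c_{i+1}$, $c_{i+1}b_i$ are non-edges. A non-edge $uv$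 is forbidden in an instance $(G,k)$ if no set $A$ of at most $k$ non-edges with $G\cup A$ prison-free contains $uv$. A graph is complete multipartite if its vertices can be partitioned into classes with two vertices adjacent iff in different classes; $\mathrm{cmd}_4(H)$ is the collection of inclusion-wise maximal $F\subseteq V(H)$ such that $H[F]$ is complete multipartite with at least $4$ classes. -}

module Defs where

open import Data.Nat using (ℕ; zero; suc; _<ᵇ_; _≤_)
open import Data.Nat.DivMod using (_mod_)
open import Data.Bool using (Bool; true; false; _∧_; if_then_else_)
open import Data.Fin using (Fin; toℕ)
open import Data.Fin.Subset using (Subset; _∈_; _⊆_)
open import Data.List using (List; []; _∷_; map; allFin)
open import Data.Nat.ListAction using (sum)
open import Data.List.Membership.Propositional using () renaming (_∈_ to _∈ₗ_)
open import Data.Product using (Σ; _×_; _,_; ∃; ∃-syntax)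
open import Data.Sum using (_⊎_)
open import Relation.Binary.PropositionalEquality using (_≡_; _≢_)
open import Relation.Nullary using (¬_)
open import Function.Bundles using (_⇔_)
open import Function.Definitions using (Injective)

BRel : ℕ → Set
BRel n = Fin n → Fin n → Bool

record Graph (n : ℕ) : Set where
  field
    adj    : BRel n
    sym    : ∀ u v → adj u v ≡ adj v u
    irrefl : ∀ u → adj u u ≡ false
open Graph public

_∪ₑ_ : ∀ {n} → Graph n → BRel n → BRel n
(G ∪ₑ A) u v = adj G u v Data.Bool.∨ A u v

pairCount : ∀ {n} → BRel n → ℕ
pairCount {n} R =
  sum (map (λ i → sum (map (λ j → if (toℕ i <ᵇ toℕ j) ∧ R i j then 1 else 0) (allFin n))) (allFin n))

NonEdgeSet : ∀ {n} → Graph n → BRel n → Set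
NonEdgeSet {n} G A =
  (∀ u v → A u v ≡ A v u) × (∀ u v → A u v ≡ true → (u ≢ v) × (adj G u v ≡ false))

PrisonNonEdge : Fin 5 → Fin 5 → Set
PrisonNonEdge i j =
  (toℕ i ≡ 0 × toℕ j ≡ 1) ⊎ (toℕ i ≡ 1 × toℕ j ≡ 0) ⊎
  (toℕ i ≡ 0 × toℕ j ≡ 2) ⊎ (toℕ i ≡ 2 × toℕ j ≡ 0)

PrisonEdge : Fin 5 → Fin 5 → Set
PrisonEdge i j = (i ≢ j) × ¬ PrisonNonEdge i j

HasInducedPrison : ∀ {n} → BRel n → Set
HasInducedPrison {n} R =
  Σ (Fin 5 → Fin n) λ f → Injective _≡_ _≡_ f ×
    (∀ i j → i ≢ j → (R (f i) (f j) ≡ true ⇔ PrisonEdge i j))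

PrisonFree : ∀ {n} → BRel n → Set
PrisonFree R = ¬ HasInducedPrison R

Solution : ∀ {n} → Graph n → ℕ → BRel n → Set
Solution G k A = NonEdgeSet G A × (pairCount A ≤ k) × PrisonFree (G ∪ₑ A)

Forbidden : ∀ {n} → Graph n → ℕ → Fin n → Fin n → Set
Forbidden {n} G k u v =
  (u ≢ v) × (adj G u v ≡ false) × (∀ (A : BRel n) → Solution G k A → A u v ≡ false)

-- Cloning component of length l: vertices (a_i, b_i, c_i), indices mod l.
data Lab : Set where
  ℓa ℓb ℓc : Lab

CVert : ℕ → Set
CVert l = Lab × Fin l

next : (l : ℕ) → Fin l → Fin l
next (suc m) i = suc (toℕ i) mod suc m

cloneEdgesAt : (l : ℕ) → Fin l → List (CVert l × CVert l)
cloneEdgesAt l i =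
  ((ℓa , next l i) , (ℓb , i)) ∷ ((ℓa , next l i) , (ℓc , i)) ∷
  ((ℓa , next l i) , (ℓa , i)) ∷ ((ℓc , next l i) , (ℓc , i)) ∷
  ((ℓc , next l i) , (ℓa , i)) ∷ ((ℓb , i) , (ℓc , i)) ∷
  ((ℓb , i) , (ℓa , i)) ∷ []

CloneAdj : (l : ℕ) → CVert l → CVert l → Set
CloneAdj l x y = ∃[ i ] ((x , y) ∈ₗ cloneEdgesAt l i ⊎ (y , x) ∈ₗ cloneEdgesAt l i)

InducedCloning : ∀ {n} → Graph n → (l : ℕ) → (CVert l → Fin n) → Set
InducedCloning G l emb =
  Injective _≡_ _≡_ emb ×
  (∀ x y → x ≢ y → (adj G (emb x) (emb y) ≡ true ⇔ CloneAdj l x y))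

-- H[F] is complete multipartite with at least 4 classes
-- (classes given by a class-labelling; the classes are the non-empty fibres on F).
CompleteMultipartite4 : ∀ {n} → BRel n → Subset n → Set
CompleteMultipartite4 {n} H F =
  Σ (Fin n → ℕ) λ cls →
    (∀ u v → u ∈ F → v ∈ F → u ≢ v → (H u v ≡ true ⇔ cls u ≢ cls v)) ×
    (∃[ w ] ∃[ x ] ∃[ y ] ∃[ z ] (w ∈ F × x ∈ F × y ∈ F × z ∈ F ×
       cls w ≢ cls x × cls w ≢ cls y × cls w ≢ cls z ×
       cls x ≢ cls y × cls x ≢ cls z × cls y ≢ cls z))

InCmd4 : ∀ {n} → BRel n → Subset n → Set
InCmd4 {n} H F =
  CompleteMultipartite4 H F × (∀ (F' : Subset n) → F ⊆ F' → CompleteMultipartite4 H F' → F' ⊆ F)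

-- If the solution adds a_i c_i, then, c_{i+1} b_i being forbidden, a_{i+1} c_{i+1} must be
-- added too, for otherwise c_{i+1}; a_{i+1}, b_i; c_i, a_i is a prison (centre first). Going
-- around the cycle, either no pair a_i c_i is added or all are. In the latter case
-- K_i = {a_i, c_i, a_{i+1}, c_{i+1}} is a 4-clique of H = G ∪ A. In a prison-free graph the
-- vertices missing at most one vertex of a clique K of size ≥ 4 have transitive non-adjacency,
-- so they form a complete multipartite set N(K); it is maximal, since a complete multipartite
-- superset of K lies inside N(K). Consecutive cliques K_i, K_{i+1} lie in each other's N, so all
-- N(K_i) coincide, and N(K_0) contains the whole cloning component.
module Submission where

open import Defs hiding (sym)
open import Data.Nat using (ℕ; _≤_)
open import Data.Bool using (true; false)
open import Data.Fin using (Fin)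
open import Data.Fin.Subset using (Subset; _∈_)
open import Data.Product using (_×_; _,_; ∃-syntax)
open import Data.Sum using (_⊎_)
open import Relation.Binary.PropositionalEquality using (_≡_)

open import Data.Bool as Bool using (Bool; _∨_)
open import Data.Bool.Properties using (¬-not; not-¬; ∨-zeroʳ)
open import Data.Empty using (⊥)
open import Data.Fin using (zero; suc; toℕ; punchIn)
open import Data.Fin.Patterns using (0F; 1F; 2F; 3F; 4F)
open import Data.Fin.Properties
  using (_≟_; all?; any?; toℕ-injective; toℕ-fromℕ<; toℕ<n; 0≢1+n; punchIn-injective; punchInᵢ≢i)
open import Data.Fin.Subset using (_⊆_)
open import Data.Fin.Subset.Properties using (_∈?_)
open import Data.List using (List; []; _∷_; allFin)
open import Data.List.Membership.Propositional using (lose) renaming (_∈_ to _∈ₗ_)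
open import Data.List.Membership.Propositional.Properties using (∈-allFin)
open import Data.List.Relation.Unary.All using (_∷_; [])
open import Data.List.Relation.Unary.All.Properties using (All¬⇒¬Any)
open import Data.List.Relation.Unary.Any using (Any; here; there)
open import Data.Nat using (zero; suc; _+_; _∸_; _%_; s≤s)
open import Data.Nat.DivMod using (m%n<n; %-distribˡ-+; m%n%n≡m%n; m<n⇒m%n≡m; [m+n]%n≡m%n)
open import Data.Nat.GeneralisedArithmetic using (iterate)
open import Data.Nat.Properties
  using (+-identityʳ; +-suc; +-assoc; +-comm; m+[n∸m]≡n; <⇒≤; suc-injective) renaming (_≟_ to _≟ℕ_)
open import Data.Product using (∃₂; proj₁; proj₂)
open import Data.Sum using (inj₁; inj₂)
open import Data.Vec using (tabulate; lookup; _∷_; [])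
open import Data.Vec.Properties using (lookup∘tabulate; []=⇒lookup; lookup⇒[]=)
open import Function using (_∘_; id)
open import Function.Bundles using (_⇔_; mk⇔; module Equivalence)
open import Function.Definitions using (Injective)
open import Level using (0ℓ)
open import Relation.Binary.PropositionalEquality
  using (_≢_; refl; sym; trans; cong; cong₂; subst; ≢-sym; module ≡-Reasoning)
open import Relation.Nullary using (¬_; Dec; yes; no; does; ¬?; contradiction)
open import Relation.Nullary.Decidable using (_×-dec_; _⊎-dec_; _→-dec_; from-yes; decidable-stable)
open import Relation.Unary using (Pred; Decidable)

open Equivalence using (to; from)

does⇔ : ∀ {A : Set} (a? : Dec A) → does a? ≡ true ⇔ A
does⇔ (yes a) = mk⇔ (λ _ → a) (λ _ → refl)
does⇔ (no ¬a) = mk⇔ (λ ()) (λ a → contradiction a ¬a)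

firstIndex : ∀ {A : Set} {P : Pred A 0ℓ} → Decidable P → List A → ℕ
firstIndex P? []       = 0
firstIndex P? (x ∷ xs) with P? x
... | yes _ = 0
... | no  _ = suc (firstIndex P? xs)

module _ {A : Set} {P Q : Pred A 0ℓ} (P? : Decidable P) (Q? : Decidable Q) where

  firstIndex-cong : (∀ x → P x ⇔ Q x) → ∀ xs → firstIndex P? xs ≡ firstIndex Q? xs
  firstIndex-cong P⇔Q []       = refl
  firstIndex-cong P⇔Q (x ∷ xs) with P? x | Q? x
  ... | yes _  | yes _  = refl
  ... | no  _  | no  _  = cong suc (firstIndex-cong P⇔Q xs)
  ... | yes px | no ¬qx = contradiction (to (P⇔Q x) px) ¬qx
  ... | no ¬px | yes qx = contradiction (from (P⇔Q x) qx) ¬px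

  firstIndex-common : ∀ {xs} → firstIndex P? xs ≡ firstIndex Q? xs → Any P xs → ∃[ x ] P x × Q x
  firstIndex-common {x ∷ xs} same any with P? x | Q? x
  ... | yes px | yes qx = x , px , qx
  firstIndex-common {x ∷ xs} () any | yes _ | no _
  firstIndex-common {x ∷ xs} () any | no _  | yes _
  firstIndex-common {x ∷ xs} same (here px)   | no ¬px | no _ = contradiction px ¬px
  firstIndex-common {x ∷ xs} same (there any) | no _   | no _ = firstIndex-common (suc-injective same) any

decSubset : ∀ {n} {P : Pred (Fin n) 0ℓ} → Decidable P → Subset n
decSubset P? = tabulate (does ∘ P?)

∈-decSubset : ∀ {n} {P : Pred (Fin n) 0ℓ} (P? : Decidable P) {x} → x ∈ decSubset P? ⇔ P x
∈-decSubset P? {x} = mk⇔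
  (λ x∈ → to (does⇔ (P? x)) (trans (sym (lookup∘tabulate (does ∘ P?) x)) ([]=⇒lookup x∈)))
  (λ Px → lookup⇒[]= x _ (trans (lookup∘tabulate (does ∘ P?) x) (from (does⇔ (P? x)) Px)))

-- Cyclic indices

module _ {l : ℕ} where
  private L = suc l

  toℕ-iterate-next : ∀ (i : Fin L) d → toℕ (iterate (next L) i d) ≡ (toℕ i + d) % L
  toℕ-iterate-next i zero = begin
    toℕ i            ≡⟨ m<n⇒m%n≡m (toℕ<n i) ⟨
    toℕ i % L        ≡⟨ cong (_% L) (+-identityʳ (toℕ i)) ⟨
    (toℕ i + 0) % L  ∎
    where open ≡-Reasoning
  toℕ-iterate-next i (suc d) = begin
    toℕ (iterate (next L) (next L i) d)  ≡⟨ toℕ-iterate-next (next L i) d ⟩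
    (toℕ (next L i) + d) % L             ≡⟨ cong (λ x → (x + d) % L) (toℕ-fromℕ< (m%n<n (suc i′) L)) ⟩
    (suc i′ % L + d) % L                 ≡⟨ %-distribˡ-+ (suc i′ % L) d L ⟩
    (suc i′ % L % L + d % L) % L         ≡⟨ cong (λ x → (x + d % L) % L) (m%n%n≡m%n (suc i′) L) ⟩
    (suc i′ % L + d % L) % L             ≡⟨ %-distribˡ-+ (suc i′) d L ⟨
    (suc i′ + d) % L                     ≡⟨ cong (_% L) (+-suc i′ d) ⟨
    (i′ + suc d) % L                     ∎
    where
    open ≡-Reasoning
    i′ = toℕ i

  iterate-next-reaches : ∀ (i j : Fin L) → iterate (next L) i (L ∸ toℕ i + toℕ j) ≡ j
  iterate-next-reaches i j = toℕ-injective (begin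
    toℕ (iterate (next L) i (L ∸ i′ + j′))  ≡⟨ toℕ-iterate-next i (L ∸ i′ + j′) ⟩
    (i′ + (L ∸ i′ + j′)) % L                ≡⟨ cong (_% L) (+-assoc i′ (L ∸ i′) j′) ⟨
    (i′ + (L ∸ i′) + j′) % L                ≡⟨ cong (λ x → (x + j′) % L) (m+[n∸m]≡n (<⇒≤ (toℕ<n i))) ⟩
    (L + j′) % L                            ≡⟨ cong (_% L) (+-comm L j′) ⟩
    (j′ + L) % L                            ≡⟨ [m+n]%n≡m%n j′ L ⟩
    j′ % L                                  ≡⟨ m<n⇒m%n≡m (toℕ<n j) ⟩
    j′                                      ∎)
    where
    open ≡-Reasoning
    i′ = toℕ i
    j′ = toℕ j

  next-induction : (P : Fin L → Set) → (∀ i → P i → P (next L i)) → ∀ i j → P i → P j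
  next-induction P step i j Pi =
    subst P (iterate-next-reaches i j) (iterate-preserves (L ∸ toℕ i + toℕ j) i Pi)
    where
    iterate-preserves : ∀ d i → P i → P (iterate (next L) i d)
    iterate-preserves zero    i Pi = Pi
    iterate-preserves (suc d) i Pi = iterate-preserves d (next L i) (step i Pi)

next-≢ : ∀ {l} (i : Fin (suc (suc l))) → next _ i ≢ i
next-≢ i next-i≡i = 0≢1+n (trans (all≡i zero) (sym (all≡i 1F)))
  where
  all≡i : ∀ j → j ≡ i
  all≡i j = next-induction (_≡ i) (λ { _ refl → next-i≡i }) i j refl

-- Prison-free graphs

prisonNonEdge? : ∀ i j → Dec (PrisonNonEdge i j)
prisonNonEdge? i j =
  toℕ i ≟ℕ 0 ×-dec toℕ j ≟ℕ 1 ⊎-dec toℕ i ≟ℕ 1 ×-dec toℕ j ≟ℕ 0 ⊎-dec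
  toℕ i ≟ℕ 0 ×-dec toℕ j ≟ℕ 2 ⊎-dec toℕ i ≟ℕ 2 ×-dec toℕ j ≟ℕ 0

prisonEdge? : ∀ i j → Dec (PrisonEdge i j)
prisonEdge? i j = ¬? (i ≟ j) ×-dec ¬? (prisonNonEdge? i j)

prisonAdj : Fin 5 → Fin 5 → Bool
prisonAdj i j = does (prisonEdge? i j)

prisonAdj-rows-injective : ∀ i j → (∀ k → prisonAdj i k ≡ prisonAdj j k) → i ≡ j
prisonAdj-rows-injective =
  from-yes (all? λ i → all? λ j → all? (λ k → prisonAdj i k Bool.≟ prisonAdj j k) →-dec i ≟ j)

module PrisonFreeGraph {n} (H : BRel n) (H-sym : ∀ u v → H u v ≡ H v u)
                       (H-irrefl : ∀ u → H u u ≡ false) (H-free : PrisonFree H) where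

  infix 4 _~_ _≁_
  _~_ _≁_ : Fin n → Fin n → Set
  u ~ v = H u v ≡ true
  u ≁ v = H u v ≡ false

  ~-sym : ∀ {u v} → u ~ v → v ~ u
  ~-sym {u} {v} u~v = trans (H-sym v u) u~v

  ≁-sym : ∀ {u v} → u ≁ v → v ≁ u
  ≁-sym {u} {v} u≁v = trans (H-sym v u) u≁v

  ~⇒≢ : ∀ {u v} → u ~ v → u ≢ v
  ~⇒≢ {u} u~u refl = not-¬ (H-irrefl u) u~u

  no-prison : ∀ {c m₁ m₂ o₁ o₂} → c ≁ m₁ → c ≁ m₂ → c ~ o₁ → c ~ o₂ →
              m₁ ~ m₂ → m₁ ~ o₁ → m₁ ~ o₂ → m₂ ~ o₁ → m₂ ~ o₂ → o₁ ~ o₂ → ⊥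
  no-prison {c} {m₁} {m₂} {o₁} {o₂} c₁ c₂ c₃ c₄ m₁₂ m₁₃ m₁₄ m₂₃ m₂₄ o₃₄ =
    H-free (vertex , vertex-injective , λ i j _ →
      subst (λ b → b ≡ true ⇔ _) (sym (table i j)) (does⇔ (prisonEdge? i j)))
    where
    vertex : Fin 5 → Fin n
    vertex 0F = c
    vertex 1F = m₁
    vertex 2F = m₂
    vertex 3F = o₁
    vertex 4F = o₂
    table : ∀ i j → H (vertex i) (vertex j) ≡ prisonAdj i j
    table 0F 0F = H-irrefl c
    table 0F 1F = c₁
    table 0F 2F = c₂
    table 0F 3F = c₃
    table 0F 4F = c₄
    table 1F 0F = ≁-sym c₁
    table 1F 1F = H-irrefl m₁
    table 1F 2F = m₁₂
    table 1F 3F = m₁₃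
    table 1F 4F = m₁₄
    table 2F 0F = ≁-sym c₂
    table 2F 1F = ~-sym m₁₂
    table 2F 2F = H-irrefl m₂
    table 2F 3F = m₂₃
    table 2F 4F = m₂₄
    table 3F 0F = ~-sym c₃
    table 3F 1F = ~-sym m₁₃
    table 3F 2F = ~-sym m₂₃
    table 3F 3F = H-irrefl o₁
    table 3F 4F = o₃₄
    table 4F 0F = ~-sym c₄
    table 4F 1F = ~-sym m₁₄
    table 4F 2F = ~-sym m₂₄
    table 4F 3F = ~-sym o₃₄
    table 4F 4F = H-irrefl o₂
    vertex-injective : Injective _≡_ _≡_ vertex
    vertex-injective {i} {j} eq = prisonAdj-rows-injective i j λ k →
      trans (sym (table i k)) (trans (cong (λ u → H u (vertex k)) eq) (table j k))

  IsClique : ∀ {m} → (Fin m → Fin n) → Set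
  IsClique p = ∀ {i j} → i ≢ j → p i ~ p j

  clique₄ : ∀ {w x y z} → w ~ x → w ~ y → w ~ z → x ~ y → x ~ z → y ~ z →
            IsClique (lookup (w ∷ x ∷ y ∷ z ∷ []))
  clique₄ wx wy wz xy xz yz {0F} {0F} 0≢0 = contradiction refl 0≢0
  clique₄ wx wy wz xy xz yz {0F} {1F} _ = wx
  clique₄ wx wy wz xy xz yz {0F} {2F} _ = wy
  clique₄ wx wy wz xy xz yz {0F} {3F} _ = wz
  clique₄ wx wy wz xy xz yz {1F} {0F} _ = ~-sym wx
  clique₄ wx wy wz xy xz yz {1F} {1F} 1≢1 = contradiction refl 1≢1
  clique₄ wx wy wz xy xz yz {1F} {2F} _ = xy
  clique₄ wx wy wz xy xz yz {1F} {3F} _ = xz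
  clique₄ wx wy wz xy xz yz {2F} {0F} _ = ~-sym wy
  clique₄ wx wy wz xy xz yz {2F} {1F} _ = ~-sym xy
  clique₄ wx wy wz xy xz yz {2F} {2F} 2≢2 = contradiction refl 2≢2
  clique₄ wx wy wz xy xz yz {2F} {3F} _ = yz
  clique₄ wx wy wz xy xz yz {3F} {0F} _ = ~-sym wz
  clique₄ wx wy wz xy xz yz {3F} {1F} _ = ~-sym xz
  clique₄ wx wy wz xy xz yz {3F} {2F} _ = ~-sym yz
  clique₄ wx wy wz xy xz yz {3F} {3F} 3≢3 = contradiction refl 3≢3

  MissesAtMostOne : ∀ {m} → (Fin m → Fin n) → Fin n → Set
  MissesAtMostOne p v = ∀ i j → i ≢ j → v ≁ p i → v ≁ p j → ⊥

  missesAtMostOne? : ∀ {m} (p : Fin m → Fin n) v → Dec (MissesAtMostOne p v)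
  missesAtMostOne? p v = all? λ i → all? λ j →
    ¬? (i ≟ j) →-dec H v (p i) Bool.≟ false →-dec H v (p j) Bool.≟ false →-dec no id

  SeesAllBut : ∀ {m} → (Fin (suc m) → Fin n) → Fin (suc m) → Fin n → Set
  SeesAllBut p k v = ∀ t → v ~ p (punchIn k t)

  NonAdjacencyTransitive : Pred (Fin n) 0ℓ → Set
  NonAdjacencyTransitive S = ∀ {u w z} → S u → S w → S z → u ≁ w → w ≁ z → u ≁ z

  module _ {m} {p : Fin m → Fin n} where

    missesAtMostOne-∘ : ∀ {k} {f : Fin k → Fin m} {v} → Injective _≡_ _≡_ f →
                        MissesAtMostOne p v → MissesAtMostOne (p ∘ f) v
    missesAtMostOne-∘ f-injective v∈N i j i≢j = v∈N _ _ (i≢j ∘ f-injective)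

    sees-rest : ∀ {v i j} → MissesAtMostOne p v → v ≁ p i → j ≢ i → v ~ p j
    sees-rest v∈N v≁pi j≢i = ¬-not (v∈N _ _ (≢-sym j≢i) v≁pi)

    adjacent-to-two⇒missesAtMostOne : IsClique p → ∀ {v a b} → a ≢ b → v ~ p a → v ~ p b →
                                      MissesAtMostOne p v
    adjacent-to-two⇒missesAtMostOne K a≢b v~pa v~pb i j i≢j v≁pi v≁pj =
      no-prison v≁pi v≁pj v~pa v~pb (K i≢j)
        (K (apart v≁pi v~pa)) (K (apart v≁pi v~pb)) (K (apart v≁pj v~pa)) (K (apart v≁pj v~pb)) (K a≢b)
      where
      apart : ∀ {v s t} → v ≁ p s → v ~ p t → s ≢ t
      apart v≁ps v~ps refl = not-¬ v≁ps v~ps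

    clique-member-missesAtMostOne : IsClique p → ∀ k → MissesAtMostOne p (p k)
    clique-member-missesAtMostOne K k i j i≢j pk≁pi pk≁pj with i ≟ k
    ... | yes refl = not-¬ pk≁pj (K i≢j)
    ... | no  i≢k  = not-¬ pk≁pi (K (≢-sym i≢k))

    nonAdjacencyTransitive⇒missesAtMostOne : ∀ {S} → NonAdjacencyTransitive S → (∀ i → S (p i)) →
                                              IsClique p → ∀ {v} → S v → MissesAtMostOne p v
    nonAdjacencyTransitive⇒missesAtMostOne T p∈S K v∈S i j i≢j v≁pi v≁pj =
      not-¬ (T (p∈S i) v∈S (p∈S j) (≁-sym v≁pi) v≁pj) (K i≢j)

  module _ {m} {p : Fin (suc m) → Fin n} where

    missing⇒seesAllBut : ∀ {v k} → MissesAtMostOne p v → v ≁ p k → SeesAllBut p k v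
    missing⇒seesAllBut {k = k} v∈N v≁pk t = sees-rest v∈N v≁pk (punchInᵢ≢i k t)

    seesAllBut-some : ∀ {v} → MissesAtMostOne p v → ∃[ k ] SeesAllBut p k v
    seesAllBut-some {v} v∈N with any? (λ k → H v (p k) Bool.≟ false)
    ... | yes (k , v≁pk) = k , missing⇒seesAllBut v∈N v≁pk
    ... | no  none       = zero , λ t → ¬-not (none ∘ (_ ,_))

  sees-two : ∀ {m} {q : Fin (3 + m) → Fin n} {v} → MissesAtMostOne q v →
             ∃₂ λ s t → s ≢ t × v ~ q s × v ~ q t
  sees-two {q = q} {v} v∈N with H v (q 0F) in e₀ | H v (q 1F) in e₁
  ... | false | _     = 1F , 2F , (λ ()) , sees-rest v∈N e₀ (λ ()) , sees-rest v∈N e₀ (λ ())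
  ... | true  | false = 0F , 2F , (λ ()) , e₀ , sees-rest v∈N e₁ (λ ())
  ... | true  | true  = 0F , 1F , (λ ()) , e₀ , e₁

  module _ {m} {p : Fin (4 + m) → Fin n} (K : IsClique p) where

    missed-by-nonneighbour : ∀ {x y j} → MissesAtMostOne p x → MissesAtMostOne p y →
                             x ≁ y → x ≁ p j → y ≁ p j
    missed-by-nonneighbour {x} {y} {j} x∈N y∈N x≁y x≁pj = ¬-not λ y~pj →
      let s , t , s≢t , y~qs , y~qt = sees-two (missesAtMostOne-∘ (punchIn-injective j _ _) y∈N)
      in no-prison x≁y x≁pj (x-sees s) (x-sees t) y~pj y~qs y~qt
           (K (punchInᵢ≢i j s ∘ sym)) (K (punchInᵢ≢i j t ∘ sym)) (K (s≢t ∘ punchIn-injective j s t))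
      where
      x-sees : SeesAllBut p j x
      x-sees = missing⇒seesAllBut x∈N x≁pj

    -- y sees all of p except possibly p k; its non-neighbours x and z inherit this by
    -- missed-by-nonneighbour, and two vertices of p other than p k complete y; x, z to a prison.
    missesAtMostOne-nonAdjacencyTransitive : NonAdjacencyTransitive (MissesAtMostOne p)
    missesAtMostOne-nonAdjacencyTransitive {x} {y} {z} x∈N y∈N z∈N x≁y y≁z = ¬-not λ x~z →
      no-prison (≁-sym x≁y) y≁z (y-sees 0F) (y-sees 1F)
        x~z (x-sees 0F) (x-sees 1F) (z-sees 0F) (z-sees 1F) (K ((λ ()) ∘ punchIn-injective k 0F 1F))
      where
      k = proj₁ (seesAllBut-some y∈N)
      y-sees = proj₂ (seesAllBut-some y∈N)
      inherit : ∀ {w} → MissesAtMostOne p w → w ≁ y → SeesAllBut p k w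
      inherit w∈N w≁y t = ¬-not λ w≁q → not-¬ (missed-by-nonneighbour w∈N y∈N w≁y w≁q) (y-sees t)
      x-sees = inherit x∈N x≁y
      z-sees = inherit z∈N (≁-sym y≁z)

    missesAtMostOne-transfer : ∀ {m′} {q : Fin m′ → Fin n} → IsClique q →
                               (∀ j → MissesAtMostOne p (q j)) →
                               ∀ {v} → MissesAtMostOne p v → MissesAtMostOne q v
    missesAtMostOne-transfer Kq q∈N =
      nonAdjacencyTransitive⇒missesAtMostOne missesAtMostOne-nonAdjacencyTransitive q∈N Kq

  classOf : Subset n → Fin n → ℕ
  classOf F u = firstIndex (λ w → w ∈? F ×-dec H u w Bool.≟ false) (allFin n)

  module _ {F : Subset n} (T : NonAdjacencyTransitive (_∈ F)) where

    ≁⇒same-class : ∀ {u v} → u ∈ F → v ∈ F → u ≁ v → classOf F u ≡ classOf F v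
    ≁⇒same-class u∈F v∈F u≁v = firstIndex-cong _ _
      (λ w → mk⇔ (λ (w∈F , u≁w) → w∈F , T v∈F u∈F w∈F (≁-sym u≁v) u≁w)
                 (λ (w∈F , v≁w) → w∈F , T u∈F v∈F w∈F u≁v v≁w))
      (allFin n)

    same-class⇒≁ : ∀ {u v} → u ∈ F → v ∈ F → classOf F u ≡ classOf F v → u ≁ v
    same-class⇒≁ {u} u∈F v∈F same
      with w , (w∈F , u≁w) , (_ , v≁w) ← firstIndex-common _ _ same (lose (∈-allFin u) (u∈F , H-irrefl u))
      = T u∈F w∈F v∈F u≁w (≁-sym v≁w)

    adjacent⇔different-class : ∀ {u v} → u ∈ F → v ∈ F → u ~ v ⇔ classOf F u ≢ classOf F v
    adjacent⇔different-class u∈F v∈F = mk⇔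
      (λ u~v same → not-¬ (same-class⇒≁ u∈F v∈F same) u~v)
      (λ different → ¬-not (different ∘ ≁⇒same-class u∈F v∈F))

    completeMultipartite4 : ∀ {m} {p : Fin (4 + m) → Fin n} → IsClique p → (∀ i → p i ∈ F) →
                            CompleteMultipartite4 H F
    completeMultipartite4 {p = p} K p∈F =
      classOf F , (λ u v u∈F v∈F _ → adjacent⇔different-class u∈F v∈F) ,
      p 0F , p 1F , p 2F , p 3F , p∈F 0F , p∈F 1F , p∈F 2F , p∈F 3F ,
      apart (λ ()) , apart (λ ()) , apart (λ ()) , apart (λ ()) , apart (λ ()) , apart (λ ())
      where
      apart : ∀ {i j} → i ≢ j → classOf F (p i) ≢ classOf F (p j)
      apart i≢j = to (adjacent⇔different-class (p∈F _) (p∈F _)) (K i≢j)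

  completeMultipartite4⇒nonAdjacencyTransitive : ∀ {F} → CompleteMultipartite4 H F →
                                                 NonAdjacencyTransitive (_∈ F)
  completeMultipartite4⇒nonAdjacencyTransitive {F} (cls , adjacent⇔ , _) u∈F w∈F z∈F u≁w w≁z =
    ¬-not λ u~z → to (adjacent⇔ _ _ u∈F z∈F (~⇒≢ u~z)) u~z
                    (trans (same-class u∈F w∈F u≁w) (same-class w∈F z∈F w≁z))
    where
    same-class : ∀ {a b} → a ∈ F → b ∈ F → a ≁ b → cls a ≡ cls b
    same-class {a} {b} a∈F b∈F a≁b with a ≟ b
    ... | yes refl = refl
    ... | no  a≢b  = decidable-stable (cls a ≟ℕ cls b) (not-¬ a≁b ∘ from (adjacent⇔ a b a∈F b∈F a≢b))

  nearSet : ∀ {m} → (Fin m → Fin n) → Subset n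
  nearSet p = decSubset (missesAtMostOne? p)

  ∈-nearSet : ∀ {m} {p : Fin m → Fin n} {v} → v ∈ nearSet p ⇔ MissesAtMostOne p v
  ∈-nearSet {p = p} = ∈-decSubset (missesAtMostOne? p)

  nearSet-InCmd4 : ∀ {m} {p : Fin (4 + m) → Fin n} → IsClique p → InCmd4 H (nearSet p)
  nearSet-InCmd4 {p = p} K = multipartite , maximal
    where
    p⊆near : ∀ i → p i ∈ nearSet p
    p⊆near i = from ∈-nearSet (clique-member-missesAtMostOne K i)
    multipartite : CompleteMultipartite4 H (nearSet p)
    multipartite = completeMultipartite4
      (λ u∈ w∈ z∈ → missesAtMostOne-nonAdjacencyTransitive K
                      (to ∈-nearSet u∈) (to ∈-nearSet w∈) (to ∈-nearSet z∈))
      K p⊆near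
    maximal : ∀ F′ → nearSet p ⊆ F′ → CompleteMultipartite4 H F′ → F′ ⊆ nearSet p
    maximal F′ near⊆F′ F′-multipartite v∈F′ = from ∈-nearSet
      (nonAdjacencyTransitive⇒missesAtMostOne (completeMultipartite4⇒nonAdjacencyTransitive F′-multipartite)
         (near⊆F′ ∘ p⊆near) K v∈F′)

-- The cloning component

module ∪ₑ-Properties {n} (G : Graph n) (A : BRel n) where

  ∪ₑ-inj₁ : ∀ {u v} → adj G u v ≡ true → (G ∪ₑ A) u v ≡ true
  ∪ₑ-inj₁ uv∈G rewrite uv∈G = refl

  ∪ₑ-inj₂ : ∀ {u v} → A u v ≡ true → (G ∪ₑ A) u v ≡ true
  ∪ₑ-inj₂ {u} {v} uv∈A rewrite uv∈A = ∨-zeroʳ (adj G u v)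

  ∪ₑ-non-edge : ∀ {u v} → adj G u v ≡ false → A u v ≡ false → (G ∪ₑ A) u v ≡ false
  ∪ₑ-non-edge uv∉G uv∉A rewrite uv∉G | uv∉A = refl

  ∪ₑ-sym : NonEdgeSet G A → ∀ u v → (G ∪ₑ A) u v ≡ (G ∪ₑ A) v u
  ∪ₑ-sym (A-sym , _) u v = cong₂ _∨_ (Graph.sym G u v) (A-sym u v)

  ∪ₑ-irrefl : NonEdgeSet G A → ∀ u → (G ∪ₑ A) u u ≡ false
  ∪ₑ-irrefl (_ , A⊆non-edges) u =
    ∪ₑ-non-edge (irrefl G u) (¬-not λ uu∈A → proj₁ (A⊆non-edges u u uu∈A) refl)

module CloningComponent {n} (G : Graph n) (A : BRel n) (A-non-edges : NonEdgeSet G A)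
                        (free : PrisonFree (G ∪ₑ A))
                        {m} (E : CVert (2 + m) → Fin n) (X : InducedCloning G (2 + m) E) where

  open ∪ₑ-Properties G A
  open PrisonFreeGraph (G ∪ₑ A) (∪ₑ-sym A-non-edges) (∪ₑ-irrefl A-non-edges) free

  l : ℕ
  l = 2 + m

  infix 10 _⁺
  _⁺ : Fin l → Fin l
  i ⁺ = next l i

  a b c : Fin l → Fin n
  a i = E (ℓa , i)
  b i = E (ℓb , i)
  c i = E (ℓc , i)

  clone-edge : ∀ {i x y} → (x , y) ∈ₗ cloneEdgesAt l i → x ≢ y → E x ~ E y
  clone-edge xy∈ x≢y = ∪ₑ-inj₁ (from (proj₂ X _ _ x≢y) (_ , inj₁ xy∈))

  a⁺~b : ∀ i → a (i ⁺) ~ b i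
  a⁺~b i = clone-edge (here refl) (λ ())

  a⁺~c : ∀ i → a (i ⁺) ~ c i
  a⁺~c i = clone-edge (there (here refl)) (λ ())

  a⁺~a : ∀ i → a (i ⁺) ~ a i
  a⁺~a i = clone-edge (there (there (here refl))) (next-≢ i ∘ cong proj₂)

  c⁺~c : ∀ i → c (i ⁺) ~ c i
  c⁺~c i = clone-edge (there (there (there (here refl)))) (next-≢ i ∘ cong proj₂)

  c⁺~a : ∀ i → c (i ⁺) ~ a i
  c⁺~a i = clone-edge (there (there (there (there (here refl))))) (λ ())

  b~c : ∀ i → b i ~ c i
  b~c i = clone-edge (there (there (there (there (there (here refl)))))) (λ ())

  b~a : ∀ i → b i ~ a i
  b~a i = clone-edge (there (there (there (there (there (there (here refl))))))) (λ ())

  a≁c-in-G : ∀ i → adj G (a i) (c i) ≡ false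
  a≁c-in-G i = ¬-not λ ac∈G → not-clone-edge (to (proj₂ X (ℓa , i) (ℓc , i) (λ ())) ac∈G)
    where
    shifted-≢ : ∀ {j} {x y : Lab} → ((x , i) , (y , i)) ≢ ((x , j ⁺) , (y , j))
    shifted-≢ {j} eq = next-≢ j (trans (sym (cong (proj₂ ∘ proj₁) eq)) (cong (proj₂ ∘ proj₂) eq))
    not-clone-edge : ¬ CloneAdj l (ℓa , i) (ℓc , i)
    not-clone-edge (_ , inj₁ ac∈) =
      All¬⇒¬Any ((λ ()) ∷ shifted-≢ ∷ (λ ()) ∷ (λ ()) ∷ (λ ()) ∷ (λ ()) ∷ (λ ()) ∷ []) ac∈
    not-clone-edge (_ , inj₂ ca∈) =
      All¬⇒¬Any ((λ ()) ∷ (λ ()) ∷ (λ ()) ∷ (λ ()) ∷ shifted-≢ ∷ (λ ()) ∷ (λ ()) ∷ []) ca∈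

  forbidden⇒c⁺≁b : ∀ {k} → pairCount A ≤ k → (∀ i → Forbidden G k (c (i ⁺)) (b i)) →
                   ∀ i → c (i ⁺) ≁ b i
  forbidden⇒c⁺≁b |A|≤k forbidden i =
    let _ , cb∉G , cb∉solutions = forbidden i
    in ∪ₑ-non-edge cb∉G (cb∉solutions A (A-non-edges , |A|≤k , free))

  Added : Fin l → Set
  Added i = A (a i) (c i) ≡ true

  added-next : (∀ i → c (i ⁺) ≁ b i) → ∀ i → Added i → Added (i ⁺)
  added-next c⁺≁b i ac∈A = ¬-not λ a⁺c⁺∉A →
    no-prison (≁-sym (∪ₑ-non-edge (a≁c-in-G (i ⁺)) a⁺c⁺∉A)) (c⁺≁b i) (c⁺~c i) (c⁺~a i)
      (a⁺~b i) (a⁺~c i) (a⁺~a i) (b~c i) (b~a i) (~-sym (∪ₑ-inj₂ ac∈A))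

  added-everywhere : (∀ i → c (i ⁺) ≁ b i) → ∀ {i} → Added i → ∀ j → Added j
  added-everywhere c⁺≁b {i} added j = next-induction Added (added-next c⁺≁b) i j added

  module _ (all-added : ∀ i → Added i) where

    K : Fin l → Fin 4 → Fin n
    K i = lookup (a i ∷ c i ∷ a (i ⁺) ∷ c (i ⁺) ∷ [])

    K-clique : ∀ i → IsClique (K i)
    K-clique i = clique₄ (∪ₑ-inj₂ (all-added i)) (~-sym (a⁺~a i)) (~-sym (c⁺~a i))
                         (~-sym (a⁺~c i)) (~-sym (c⁺~c i)) (∪ₑ-inj₂ (all-added (i ⁺)))

    K-missesAtMostOne-K⁺ : ∀ i j → MissesAtMostOne (K (i ⁺)) (K i j)
    K-missesAtMostOne-K⁺ i 0F = adjacent-to-two⇒missesAtMostOne (K-clique (i ⁺)) {a = 0F} {1F} (λ ())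
                                  (~-sym (a⁺~a i)) (~-sym (c⁺~a i))
    K-missesAtMostOne-K⁺ i 1F = adjacent-to-two⇒missesAtMostOne (K-clique (i ⁺)) {a = 0F} {1F} (λ ())
                                  (~-sym (a⁺~c i)) (~-sym (c⁺~c i))
    K-missesAtMostOne-K⁺ i 2F = clique-member-missesAtMostOne (K-clique (i ⁺)) 0F
    K-missesAtMostOne-K⁺ i 3F = clique-member-missesAtMostOne (K-clique (i ⁺)) 1F

    missesAtMostOne-K₀ : ∀ i {v} → MissesAtMostOne (K i) v → MissesAtMostOne (K zero) v
    missesAtMostOne-K₀ i =
      next-induction (λ i → ∀ {v} → MissesAtMostOne (K i) v → MissesAtMostOne (K zero) v)
        (λ i K-to-K₀ → K-to-K₀ ∘ missesAtMostOne-transfer (K-clique (i ⁺)) (K-clique i) (K-missesAtMostOne-K⁺ i))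
        zero i id

    cloning-missesAtMostOne-K₀ : ∀ x → MissesAtMostOne (K zero) (E x)
    cloning-missesAtMostOne-K₀ (ℓa , i) = missesAtMostOne-K₀ i (clique-member-missesAtMostOne (K-clique i) 0F)
    cloning-missesAtMostOne-K₀ (ℓc , i) = missesAtMostOne-K₀ i (clique-member-missesAtMostOne (K-clique i) 1F)
    cloning-missesAtMostOne-K₀ (ℓb , i) = missesAtMostOne-K₀ i
      (adjacent-to-two⇒missesAtMostOne (K-clique i) {a = 0F} {1F} (λ ()) (b~a i) (b~c i))

    cloning-in-cmd₄ : ∃[ F ] (InCmd4 (G ∪ₑ A) F × ∀ x → E x ∈ F)
    cloning-in-cmd₄ =
      nearSet (K zero) , nearSet-InCmd4 (K-clique zero) , from ∈-nearSet ∘ cloning-missesAtMostOne-K₀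

lemma12 : ∀ {n} (G : Graph n) (l k : ℕ) → 4 ≤ l → 1 ≤ k →
    (emb : CVert l → Fin n) → InducedCloning G l emb →
    (∀ (i : Fin l) → Forbidden G k (emb (ℓc , next l i)) (emb (ℓb , i))) →
    (A : BRel n) → NonEdgeSet G A → pairCount A ≤ k → PrisonFree (G ∪ₑ A) →
    (∀ (i : Fin l) → A (emb (ℓa , i)) (emb (ℓc , i)) ≡ false)
    ⊎ ((∀ (i : Fin l) → A (emb (ℓa , i)) (emb (ℓc , i)) ≡ true)
       × ∃[ F ] (InCmd4 (G ∪ₑ A) F × (∀ (x : CVert l) → emb x ∈ F)))
lemma12 G _ k (s≤s (s≤s _)) _ E X forbidden A A-non-edges |A|≤k free
  with any? (λ i → A (E (ℓa , i)) (E (ℓc , i)) Bool.≟ true)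
... | no  none        = inj₁ λ i → ¬-not (none ∘ (i ,_))
... | yes (_ , added) = inj₂ (all-added , cloning-in-cmd₄ all-added)
  where
  open CloningComponent G A A-non-edges free E X
  all-added : ∀ i → Added i
  all-added = added-everywhere (forbidden⇒c⁺≁b |A|≤k forbidden) added
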